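{- Let $q\geqslant2$ be an even integer, $n\geqslant4$, and let $f:\mathbb{F}_2^n\to\mathbb{Z}_q$ be a self-dual generalized bent function. For $a,b\in\mathbb{F}_2$ let $F^{ab}\in\mathbb{C}^{2^{n-2}}$ be the vector $(\omega^{f(a,b,x)})_{x\in\mathbb{F}_2^{n-2}}$ (with a fixed ordering of $\mathbb{F}_2^{n-2}$), so that the sign function of $f$ is $(F^{00},F^{01},F^{10},F^{11})$. Then $$\langle F^{00},F^{01}\rangle+\langle F^{10},F^{11}\rangle=0,\qquad \langle F^{00},F^{10}\rangle+\langle F^{01},F^{11}\rangle=0,$$ where $\langle u,v\rangle=\sum_j u_j\overline{v_j}$ is the Hermitian inner product on $\mathbb{C}^{2^{n-2}}$.
   Context: $\omega=e^{2\pi i/q}$. $H_f(y)=\sum_{x\in\mathbb{F}_2^n}\omega^{f(x)}(-1)^{\langle x,y\rangle}$ with $\langle x,y\rangle=\bigoplus_ix_iy_i$. $f$ is self-dual generalized bent if $H_f(y)=2^{n/2}\omega^{f(y)}$ for all $y\in\mathbb{F}_2^n$. -}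

module Defs where

open import Level using (_⊔_) renaming (suc to lsuc)
open import Algebra.Bundles using (CommutativeRing)
open import Data.Nat using (ℕ; zero; suc; _<_; _≤_)
open import Data.Bool using (Bool; true; false; if_then_else_; _xor_; _∧_)
open import Data.Vec using (Vec; []; _∷_)
open import Data.List using (List; []; _∷_; map; _++_; foldr)
open import Data.Fin using (Fin; toℕ)
open import Data.Product using (∃; _×_)
open import Relation.Nullary using (¬_)

ringℕ : ∀ {c ℓ} (R : CommutativeRing c ℓ) → ℕ → CommutativeRing.Carrier R
ringℕ R zero = CommutativeRing.0# R
ringℕ R (suc k) = CommutativeRing._+_ R (CommutativeRing.1# R) (ringℕ R k)

-- An abstract model of the complex numbers: a field of characteristic 0
-- equipped with complex conjugation (an involutive ring automorphism).
-- ℂ with ordinary conjugation is an instance.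
record ComplexModel c ℓ : Set (lsuc (c ⊔ ℓ)) where
  field
    cring : CommutativeRing c ℓ
  open CommutativeRing cring public
  fromℕ : ℕ → Carrier
  fromℕ = ringℕ cring
  field
    nontrivial : ¬ (1# ≈ 0#)
    inverse    : ∀ x → ¬ (x ≈ 0#) → ∃ λ y → x * y ≈ 1#
    char0      : ∀ k → ¬ (fromℕ (suc k) ≈ 0#)
    conj       : Carrier → Carrier
    conj-cong  : ∀ {x y} → x ≈ y → conj x ≈ conj y
    conj-+     : ∀ x y → conj (x + y) ≈ conj x + conj y
    conj-*     : ∀ x y → conj (x * y) ≈ conj x * conj y
    conj-1     : conj 1# ≈ 1#
    conj-invol : ∀ x → conj (conj x) ≈ x

module WithModel {c ℓ} (K : ComplexModel c ℓ) where
  open ComplexModel K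

  infixr 8 _^_
  _^_ : Carrier → ℕ → Carrier
  x ^ zero = 1#
  x ^ suc k = x * (x ^ k)

  IsPrimitiveRoot : Carrier → ℕ → Set ℓ
  IsPrimitiveRoot ω q = (ω ^ q ≈ 1#) × (∀ k → 0 < k → k < q → ¬ (ω ^ k ≈ 1#))

  vecs : (n : ℕ) → List (Vec Bool n)
  vecs zero = [] ∷ []
  vecs (suc n) = map (false ∷_) (vecs n) ++ map (true ∷_) (vecs n)

  sumL : List Carrier → Carrier
  sumL = foldr _+_ 0#

  Σ𝔽₂ : (n : ℕ) → (Vec Bool n → Carrier) → Carrier
  Σ𝔽₂ n g = sumL (map g (vecs n))

  dot : {n : ℕ} → Vec Bool n → Vec Bool n → Bool
  dot [] [] = false
  dot (a ∷ x) (b ∷ y) = (a ∧ b) xor dot x y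

  sgn : Bool → Carrier
  sgn b = if b then - 1# else 1#

  wpow : (ω : Carrier) {q n : ℕ} → (Vec Bool n → Fin q) → Vec Bool n → Carrier
  wpow ω f x = ω ^ toℕ (f x)

  walsh : (ω : Carrier) {q n : ℕ} → (Vec Bool n → Fin q) → Vec Bool n → Carrier
  walsh ω {n = n} f y = Σ𝔽₂ n (λ x → wpow ω f x * sgn (dot x y))

  -- self-dual generalized bent: H_f(y) = 2^{n/2} ω^{f(y)}, where λ plays 2^{n/2}
  SelfDualGBent : (ω λ₀ : Carrier) {q n : ℕ} → (Vec Bool n → Fin q) → Set ℓ
  SelfDualGBent ω λ₀ f = ∀ y → walsh ω f y ≈ λ₀ * wpow ω f y

  innerF : (ω : Carrier) {q m : ℕ} → (Vec Bool (suc (suc m)) → Fin q) →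
           Bool → Bool → Bool → Bool → Carrier
  innerF ω {m = m} f a b a' b' =
    Σ𝔽₂ m (λ x → wpow ω f (a ∷ b ∷ x) * conj (wpow ω f (a' ∷ b' ∷ x)))

{-# OPTIONS --safe #-}
module Submission where

-- Write F a b x = ω^f(a,b,x) and let H be the Walsh–Hadamard transform on 𝔽₂^(n-2); H is
-- self-adjoint for ⟪_,_⟫ because its kernel (-1)^⟨x,y⟩ is real and symmetric. Splitting off
-- the first two coordinates, self-duality reads λ F c d = Σ_{a,b} (-1)^(ac+bd) H (F a b).
-- Hence H maps the row combinations F c 0 ± F c 1 to multiples of the column combinations
-- F 0 e ± F 1 e and back, and self-adjointness gives
--   ⟪F c 0 + F c 1 , F c 0 - F c 1⟫ = ⟪F 0 0 + (-1)^c F 1 0 , F 0 1 + (-1)^c F 1 1⟫.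
-- All F a b have the same norm, so summing over c yields conj s - s = 2 s for
-- s = ⟪F 0 0 , F 0 1⟫ + ⟪F 1 0 , F 1 1⟫. Then conj s = 3 s, so s = 9 s and s = 0 in
-- characteristic 0. Exchanging the roles of a and b gives the second identity.

open import Defs
open import Level using (Level)
open import Algebra.Bundles using (CommutativeRing)
import Algebra.Solver.Ring.AlmostCommutativeRing as ACR
open import Data.Bool using (Bool; true; false; _∧_; _xor_)
import Data.Bool.Properties as Bool
open import Data.Fin using (Fin; toℕ)
open import Data.Integer as ℤ using (ℤ; +_; -[1+_]; _⊖_)
import Data.Integer.Properties as ℤ
open import Data.List using (List; []; _∷_; map; _++_)
import Data.List.Properties as List
open import Data.Maybe using (Maybe; just; nothing)
open import Data.Nat as ℕ using (ℕ; zero; suc; _≤_)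
import Data.Nat.Properties as ℕ
open import Data.Nat.Divisibility using (_∣_)
open import Data.Product using (_×_; _,_)
open import Data.Sign as Sign using (Sign)
open import Data.Vec using (Vec; []; _∷_)
open import Function using (_∘_)
open import Relation.Nullary using (¬_; yes; no)
open import Relation.Binary.PropositionalEquality as ≡ using (_≡_)

-- The ring solver needs coefficients with decidable equality; ℤ maps into every commutative ring.
module IntegerSolver {c ℓ} (R : CommutativeRing c ℓ) where
  open CommutativeRing R
  open import Algebra.Properties.Ring ring using (-‿involutive; -0#≈0#; -‿distribˡ-*; -‿+-comm)
  open import Algebra.Properties.CommutativeSemigroup +-commutativeSemigroup
    using () renaming (interchange to +-interchange)
  open import Algebra.Properties.CommutativeSemigroup *-commutativeSemigroup
    using () renaming (interchange to *-interchange)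
  open import Algebra.Properties.Semiring.Mult.TCOptimised semiring using (1+×; ×-homo-+; ×1-homo-*)
    renaming (_×_ to _·_)
  open import Relation.Binary.Reasoning.Setoid setoid

  -- The optimised multiple satisfies 1 · x = x definitionally, so con (+ 1) denotes 1# itself.
  fromℤ : ℤ → Carrier
  fromℤ (+ n) = n · 1#
  fromℤ (-[1+ n ]) = - (suc n · 1#)

  ⊖-homo : ∀ m n → fromℤ (m ⊖ n) ≈ m · 1# - n · 1#
  ⊖-homo zero zero = sym (-‿inverseʳ 0#)
  ⊖-homo (suc m) zero = sym (trans (+-congˡ -0#≈0#) (+-identityʳ _))
  ⊖-homo zero (suc n) = sym (+-identityˡ _)
  ⊖-homo (suc m) (suc n) = begin
    fromℤ (suc m ⊖ suc n)          ≡⟨ ≡.cong fromℤ (ℤ.[1+m]⊖[1+n]≡m⊖n m n) ⟩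
    fromℤ (m ⊖ n)                  ≈⟨ ⊖-homo m n ⟩
    m · 1# - n · 1#                ≈⟨ cancel-1# (m · 1#) (n · 1#) ⟨
    (1# + m · 1#) - (1# + n · 1#)  ≈⟨ +-cong (1+× m 1#) (-‿cong (1+× n 1#)) ⟨
    suc m · 1# - suc n · 1#        ∎
    where
    cancel-1# : ∀ x y → (1# + x) - (1# + y) ≈ x - y
    cancel-1# x y = begin
      (1# + x) - (1# + y)       ≈⟨ +-congˡ (-‿+-comm 1# y) ⟨
      (1# + x) + (- 1# + - y)   ≈⟨ +-interchange 1# x (- 1#) (- y) ⟩
      (1# - 1#) + (x - y)       ≈⟨ +-congʳ (-‿inverseʳ 1#) ⟩
      0# + (x - y)              ≈⟨ +-identityˡ _ ⟩
      x - y                     ∎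

  +-homo : ∀ i j → fromℤ (i ℤ.+ j) ≈ fromℤ i + fromℤ j
  +-homo (+ m) (+ n) = ×-homo-+ 1# m n
  +-homo (+ m) -[1+ n ] = ⊖-homo m (suc n)
  +-homo -[1+ m ] (+ n) = trans (⊖-homo n (suc m)) (+-comm _ _)
  +-homo -[1+ m ] -[1+ n ] = begin
    - (suc (suc (m ℕ.+ n)) · 1#)     ≡⟨ ≡.cong (λ k → - (suc k · 1#)) (ℕ.+-suc m n) ⟨
    - ((suc m ℕ.+ suc n) · 1#)       ≈⟨ -‿cong (×-homo-+ 1# (suc m) (suc n)) ⟩
    - (suc m · 1# + suc n · 1#)      ≈⟨ -‿+-comm _ _ ⟨
    - (suc m · 1#) + - (suc n · 1#)  ∎

  fromSign : Sign → Carrier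
  fromSign Sign.+ = 1#
  fromSign Sign.- = - 1#

  sign-homo : ∀ s t → fromSign (s Sign.* t) ≈ fromSign s * fromSign t
  sign-homo Sign.+ t = sym (*-identityˡ _)
  sign-homo Sign.- Sign.+ = sym (*-identityʳ _)
  sign-homo Sign.- Sign.- = begin
    1#            ≈⟨ -‿involutive 1# ⟨
    - - 1#        ≈⟨ -‿cong (*-identityˡ (- 1#)) ⟨
    - (1# * - 1#) ≈⟨ -‿distribˡ-* 1# (- 1#) ⟩
    - 1# * - 1#   ∎

  ◃-homo : ∀ s n → fromℤ (s ℤ.◃ n) ≈ fromSign s * n · 1#
  ◃-homo s zero = sym (zeroʳ _)
  ◃-homo Sign.+ (suc n) = sym (*-identityˡ _)
  ◃-homo Sign.- (suc n) = trans (-‿cong (sym (*-identityˡ _))) (-‿distribˡ-* _ _)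

  sign-abs : ∀ i → fromℤ i ≈ fromSign (ℤ.sign i) * ℤ.∣ i ∣ · 1#
  sign-abs i = trans (reflexive (≡.cong fromℤ (≡.sym (ℤ.◃-inverse i)))) (◃-homo (ℤ.sign i) ℤ.∣ i ∣)

  *-homo : ∀ i j → fromℤ (i ℤ.* j) ≈ fromℤ i * fromℤ j
  *-homo i j = begin
    fromℤ (i ℤ.* j)
      ≈⟨ ◃-homo (ℤ.sign i Sign.* ℤ.sign j) (ℤ.∣ i ∣ ℕ.* ℤ.∣ j ∣) ⟩
    fromSign (ℤ.sign i Sign.* ℤ.sign j) * (ℤ.∣ i ∣ ℕ.* ℤ.∣ j ∣) · 1#
      ≈⟨ *-cong (sign-homo (ℤ.sign i) (ℤ.sign j)) (×1-homo-* ℤ.∣ i ∣ ℤ.∣ j ∣) ⟩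
    (fromSign (ℤ.sign i) * fromSign (ℤ.sign j)) * (ℤ.∣ i ∣ · 1# * ℤ.∣ j ∣ · 1#)
      ≈⟨ *-interchange _ _ _ _ ⟩
    (fromSign (ℤ.sign i) * ℤ.∣ i ∣ · 1#) * (fromSign (ℤ.sign j) * ℤ.∣ j ∣ · 1#)
      ≈⟨ *-cong (sign-abs i) (sign-abs j) ⟨
    fromℤ i * fromℤ j ∎

  neg-homo : ∀ i → fromℤ (ℤ.- i) ≈ - fromℤ i
  neg-homo (+ zero) = sym -0#≈0#
  neg-homo (+ suc n) = refl
  neg-homo -[1+ n ] = sym (-‿involutive _)

  homomorphism : ACR._-Raw-AlmostCommutative⟶_ ℤ.+-*-rawRing (ACR.fromCommutativeRing R)
  homomorphism = record
    { ⟦_⟧ = fromℤ ; +-homo = +-homo ; *-homo = *-homo ; -‿homo = neg-homo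
    ; 0-homo = refl ; 1-homo = refl }

  coefficients≟ : ∀ i j → Maybe (fromℤ i ≈ fromℤ j)
  coefficients≟ i j with i ℤ.≟ j
  ... | yes ≡.refl = just refl
  ... | no _ = nothing

  open import Algebra.Solver.Ring ℤ.+-*-rawRing (ACR.fromCommutativeRing R) homomorphism coefficients≟ public

module WalshAnalysis {c ℓ} (K : ComplexModel c ℓ) where
  open ComplexModel K
  open WithModel K
  open IntegerSolver cring using (fromℤ; solve; _:=_; _:+_; _:-_; _:*_; :-_; con)
  open import Algebra.Properties.Group +-group using (identityˡ-unique; inverseʳ-unique)
  open import Algebra.Properties.CommutativeSemigroup +-commutativeSemigroup
    using () renaming (interchange to +-interchange)
  open import Algebra.Properties.CommutativeSemigroup *-commutativeSemigroup
    using (x∙yz≈y∙xz) renaming (interchange to *-interchange)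
  open import Algebra.Properties.Monoid.Mult.TCOptimised +-monoid using (×ᵤ≈×)
  open import Relation.Binary.Reasoning.Setoid setoid

  conj-0# : conj 0# ≈ 0#
  conj-0# = identityˡ-unique (conj 0#) (conj 0#)
    (trans (sym (conj-+ 0# 0#)) (conj-cong (+-identityˡ 0#)))

  conj-neg : ∀ x → conj (- x) ≈ - conj x
  conj-neg x = inverseʳ-unique (conj x) (conj (- x))
    (trans (sym (conj-+ x (- x))) (trans (conj-cong (-‿inverseʳ x)) conj-0#))

  conj-sgn : ∀ b → conj (sgn b) ≈ sgn b
  conj-sgn false = conj-1
  conj-sgn true = trans (conj-neg 1#) (-‿cong conj-1)

  conj-two : conj (1# + 1#) ≈ 1# + 1#
  conj-two = trans (conj-+ 1# 1#) (+-cong conj-1 conj-1)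

  sgn-xor : ∀ a b → sgn (a xor b) ≈ sgn a * sgn b
  sgn-xor false b = sym (*-identityˡ _)
  sgn-xor true false = sym (*-identityʳ _)
  sgn-xor true true = solve 0 (con (+ 1) := :- con (+ 1) :* :- con (+ 1)) refl

  *-cancelˡ : ∀ {a x y} → ¬ a ≈ 0# → a * x ≈ a * y → x ≈ y
  *-cancelˡ {a} {x} {y} a≉0 ax≈ay with inverse a a≉0
  ... | a⁻¹ , aa⁻¹≈1 = begin
    x              ≈⟨ undo x ⟨
    a⁻¹ * (a * x)  ≈⟨ *-congˡ ax≈ay ⟩
    a⁻¹ * (a * y)  ≈⟨ undo y ⟩
    y              ∎
    where
    undo : ∀ z → a⁻¹ * (a * z) ≈ z
    undo z = begin
      a⁻¹ * (a * z)  ≈⟨ *-assoc a⁻¹ a z ⟨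
      (a⁻¹ * a) * z  ≈⟨ *-congʳ (trans (*-comm a⁻¹ a) aa⁻¹≈1) ⟩
      1# * z         ≈⟨ *-identityˡ z ⟩
      z              ∎

  ^-nonzero : ∀ {a} → ¬ a ≈ 0# → ∀ k → ¬ a ^ k ≈ 0#
  ^-nonzero a≉0 zero = nontrivial
  ^-nonzero {a} a≉0 (suc k) aᵏ⁺¹≈0 =
    ^-nonzero a≉0 k (*-cancelˡ a≉0 (trans aᵏ⁺¹≈0 (sym (zeroʳ a))))

  root-nonzero : ∀ {x y} → ¬ y ≈ 0# → x * x ≈ y → ¬ x ≈ 0#
  root-nonzero {x} y≉0 x²≈y x≈0 = y≉0 (trans (sym x²≈y) (trans (*-congʳ x≈0) (zeroˡ x)))

  unit-^ : ∀ {x} → x * conj x ≈ 1# → ∀ k → x ^ k * conj (x ^ k) ≈ 1#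
  unit-^ x-unit zero = trans (*-congˡ conj-1) (*-identityʳ 1#)
  unit-^ {x} x-unit (suc k) = begin
    (x * x ^ k) * conj (x * x ^ k)         ≈⟨ *-congˡ (conj-* x (x ^ k)) ⟩
    (x * x ^ k) * (conj x * conj (x ^ k))  ≈⟨ *-interchange _ _ _ _ ⟩
    (x * conj x) * (x ^ k * conj (x ^ k))  ≈⟨ *-cong x-unit (unit-^ x-unit k) ⟩
    1# * 1#                                ≈⟨ *-identityˡ 1# ⟩
    1#                                     ∎

  conj≈3*⇒≈0 : ∀ {s} → conj s ≈ s + (s + s) → s ≈ 0#
  conj≈3*⇒≈0 {s} conj-s = *-cancelˡ eight≉0 (begin
    fromℤ (+ 8) * s      ≈⟨ eight s ⟩
    (t + (t + t)) - s    ≈⟨ +-congʳ nine ⟨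
    s - s                ≈⟨ -‿inverseʳ s ⟩
    0#                   ≈⟨ zeroʳ _ ⟨
    fromℤ (+ 8) * 0#     ∎)
    where
    t : Carrier
    t = s + (s + s)
    nine : s ≈ t + (t + t)
    nine = begin
      s                           ≈⟨ conj-invol s ⟨
      conj (conj s)               ≈⟨ conj-cong conj-s ⟩
      conj (s + (s + s))          ≈⟨ trans (conj-+ _ _) (+-congˡ (conj-+ _ _)) ⟩
      conj s + (conj s + conj s)  ≈⟨ +-cong conj-s (+-cong conj-s conj-s) ⟩
      t + (t + t)                 ∎
    eight : ∀ s → fromℤ (+ 8) * s ≈ ((s + (s + s)) + ((s + (s + s)) + (s + (s + s)))) - s
    eight = solve 1 (λ s → con (+ 8) :* s := ((s :+ (s :+ s)) :+ ((s :+ (s :+ s)) :+ (s :+ (s :+ s)))) :- s) refl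
    eight≉0 : ¬ fromℤ (+ 8) ≈ 0#
    eight≉0 eight≈0 = char0 7 (trans (×ᵤ≈× 8 1#) eight≈0)

  ∑ : {A : Set} → List A → (A → Carrier) → Carrier
  ∑ xs g = sumL (map g xs)

  module _ {A : Set} where

    ∑-cong : ∀ xs {g h : A → Carrier} → (∀ x → g x ≈ h x) → ∑ xs g ≈ ∑ xs h
    ∑-cong [] g≈h = refl
    ∑-cong (x ∷ xs) g≈h = +-cong (g≈h x) (∑-cong xs g≈h)

    ∑-0# : ∀ xs → ∑ xs (λ (_ : A) → 0#) ≈ 0#
    ∑-0# [] = refl
    ∑-0# (x ∷ xs) = trans (+-congˡ (∑-0# xs)) (+-identityʳ 0#)

    ∑-+ : ∀ xs (g h : A → Carrier) → ∑ xs (λ x → g x + h x) ≈ ∑ xs g + ∑ xs h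
    ∑-+ [] g h = sym (+-identityʳ 0#)
    ∑-+ (x ∷ xs) g h = trans (+-congˡ (∑-+ xs g h)) (+-interchange _ _ _ _)

    ∑-*ˡ : ∀ xs a (g : A → Carrier) → ∑ xs (λ x → a * g x) ≈ a * ∑ xs g
    ∑-*ˡ [] a g = sym (zeroʳ a)
    ∑-*ˡ (x ∷ xs) a g = trans (+-congˡ (∑-*ˡ xs a g)) (sym (distribˡ a _ _))

    ∑-*ʳ : ∀ xs a (g : A → Carrier) → ∑ xs (λ x → g x * a) ≈ ∑ xs g * a
    ∑-*ʳ xs a g = trans (∑-cong xs (λ x → *-comm (g x) a)) (trans (∑-*ˡ xs a g) (*-comm a _))

    ∑-++ : ∀ xs ys (g : A → Carrier) → ∑ (xs ++ ys) g ≈ ∑ xs g + ∑ ys g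
    ∑-++ [] ys g = sym (+-identityˡ _)
    ∑-++ (x ∷ xs) ys g = trans (+-congˡ (∑-++ xs ys g)) (sym (+-assoc _ _ _))

    ∑-map : ∀ {B : Set} (h : B → A) xs (g : A → Carrier) → ∑ (map h xs) g ≡ ∑ xs (g ∘ h)
    ∑-map h xs g = ≡.cong sumL (≡.sym (List.map-∘ xs))

    conj-∑ : ∀ xs (g : A → Carrier) → conj (∑ xs g) ≈ ∑ xs (conj ∘ g)
    conj-∑ [] g = conj-0#
    conj-∑ (x ∷ xs) g = trans (conj-+ _ _) (+-congˡ (conj-∑ xs g))

    ∑-comm : ∀ {B : Set} xs (ys : List B) (h : A → B → Carrier) →
             ∑ ys (λ y → ∑ xs (λ x → h x y)) ≈ ∑ xs (λ x → ∑ ys (h x))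
    ∑-comm xs [] h = sym (∑-0# xs)
    ∑-comm xs (y ∷ ys) h =
      trans (+-congˡ (∑-comm xs ys h)) (sym (∑-+ xs (λ x → h x y) (λ x → ∑ ys (h x))))

  Σ𝔽₂-suc : ∀ n (g : Vec Bool (suc n) → Carrier) →
            Σ𝔽₂ (suc n) g ≈ Σ𝔽₂ n (g ∘ (false ∷_)) + Σ𝔽₂ n (g ∘ (true ∷_))
  Σ𝔽₂-suc n g = trans (∑-++ (map (false ∷_) (vecs n)) (map (true ∷_) (vecs n)) g)
    (+-cong (reflexive (∑-map (false ∷_) (vecs n) g)) (reflexive (∑-map (true ∷_) (vecs n) g)))

  dot-comm : ∀ {n} (x y : Vec Bool n) → dot x y ≡ dot y x
  dot-comm [] [] = ≡.refl
  dot-comm (a ∷ x) (b ∷ y) = ≡.cong₂ _xor_ (Bool.∧-comm a b) (dot-comm x y)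

  Fun : ℕ → Set c
  Fun m = Vec Bool m → Carrier

  infix  4 _≐_
  infixl 6 _⊕_
  infixr 7 _⊛_

  _≐_ : ∀ {m} → Fun m → Fun m → Set ℓ
  u ≐ v = ∀ x → u x ≈ v x

  _⊕_ : ∀ {m} → Fun m → Fun m → Fun m
  (u ⊕ v) x = u x + v x

  _⊛_ : ∀ {m} → Carrier → Fun m → Fun m
  (a ⊛ u) x = a * u x

  -- These unfold definitionally to innerF and walsh of Defs.
  ⟪_,_⟫ : ∀ {m} → Fun m → Fun m → Carrier
  ⟪_,_⟫ {m} u v = Σ𝔽₂ m (λ x → u x * conj (v x))

  hadamard : ∀ {m} → Fun m → Fun m
  hadamard {m} u y = Σ𝔽₂ m (λ x → u x * sgn (dot x y))

  module _ {m : ℕ} where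

    ⟪⟫-congˡ : ∀ {u u' : Fun m} v → u ≐ u' → ⟪ u , v ⟫ ≈ ⟪ u' , v ⟫
    ⟪⟫-congˡ v u≐u' = ∑-cong (vecs m) (λ x → *-congʳ (u≐u' x))

    ⟪⟫-congʳ : ∀ (u : Fun m) {v v'} → v ≐ v' → ⟪ u , v ⟫ ≈ ⟪ u , v' ⟫
    ⟪⟫-congʳ u v≐v' = ∑-cong (vecs m) (λ x → *-congˡ (conj-cong (v≐v' x)))

    ⟪⟫-⊕ˡ : ∀ (u u' v : Fun m) → ⟪ u ⊕ u' , v ⟫ ≈ ⟪ u , v ⟫ + ⟪ u' , v ⟫
    ⟪⟫-⊕ˡ u u' v = trans (∑-cong (vecs m) (λ x → distribʳ _ _ _)) (∑-+ (vecs m) _ _)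

    ⟪⟫-⊕ʳ : ∀ (u v v' : Fun m) → ⟪ u , v ⊕ v' ⟫ ≈ ⟪ u , v ⟫ + ⟪ u , v' ⟫
    ⟪⟫-⊕ʳ u v v' = trans (∑-cong (vecs m) (λ x → trans (*-congˡ (conj-+ _ _)) (distribˡ _ _ _)))
                         (∑-+ (vecs m) _ _)

    ⟪⟫-⊛ˡ : ∀ a (u v : Fun m) → ⟪ a ⊛ u , v ⟫ ≈ a * ⟪ u , v ⟫
    ⟪⟫-⊛ˡ a u v = trans (∑-cong (vecs m) (λ x → *-assoc _ _ _)) (∑-*ˡ (vecs m) a _)

    ⟪⟫-⊛ʳ : ∀ a (u v : Fun m) → ⟪ u , a ⊛ v ⟫ ≈ conj a * ⟪ u , v ⟫
    ⟪⟫-⊛ʳ a u v = trans (∑-cong (vecs m) (λ x → trans (*-congˡ (conj-* a (v x))) (x∙yz≈y∙xz _ _ _)))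
                        (∑-*ˡ (vecs m) (conj a) _)

    conj-⟪⟫ : ∀ (u v : Fun m) → conj ⟪ u , v ⟫ ≈ ⟪ v , u ⟫
    conj-⟪⟫ u v = trans (conj-∑ (vecs m) _) (∑-cong (vecs m) (λ x →
      trans (conj-* (u x) (conj (v x))) (trans (*-congˡ (conj-invol (v x))) (*-comm _ _))))

    ⟪⟫-expand : ∀ (u u' v v' : Fun m) s t → conj t ≈ t →
      ⟪ u ⊕ s ⊛ u' , v ⊕ t ⊛ v' ⟫ ≈ (⟪ u , v ⟫ + t * ⟪ u , v' ⟫) + (s * ⟪ u' , v ⟫ + s * (t * ⟪ u' , v' ⟫))
    ⟪⟫-expand u u' v v' s t t-real = begin
      ⟪ u ⊕ s ⊛ u' , w ⟫               ≈⟨ ⟪⟫-⊕ˡ u (s ⊛ u') w ⟩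
      ⟪ u , w ⟫ + ⟪ s ⊛ u' , w ⟫       ≈⟨ +-congˡ (⟪⟫-⊛ˡ s u' w) ⟩
      ⟪ u , w ⟫ + s * ⟪ u' , w ⟫       ≈⟨ +-cong (expandʳ u) (trans (*-congˡ (expandʳ u')) (distribˡ s _ _)) ⟩
      (⟪ u , v ⟫ + t * ⟪ u , v' ⟫) + (s * ⟪ u' , v ⟫ + s * (t * ⟪ u' , v' ⟫)) ∎
      where
      w : Fun m
      w = v ⊕ t ⊛ v'
      expandʳ : ∀ u → ⟪ u , w ⟫ ≈ ⟪ u , v ⟫ + t * ⟪ u , v' ⟫
      expandʳ u = trans (⟪⟫-⊕ʳ u v (t ⊛ v')) (+-congˡ (trans (⟪⟫-⊛ʳ t u v') (*-congʳ t-real)))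

    hadamard-⊕ : ∀ (u v : Fun m) → hadamard (u ⊕ v) ≐ hadamard u ⊕ hadamard v
    hadamard-⊕ u v y = trans (∑-cong (vecs m) (λ x → distribʳ _ _ _)) (∑-+ (vecs m) _ _)

    hadamard-⊛ : ∀ a (u : Fun m) → hadamard (a ⊛ u) ≐ a ⊛ hadamard u
    hadamard-⊛ a u y = trans (∑-cong (vecs m) (λ x → *-assoc _ _ _)) (∑-*ˡ (vecs m) a _)

    hadamard-selfAdjoint : ∀ (u v : Fun m) → ⟪ hadamard u , v ⟫ ≈ ⟪ u , hadamard v ⟫
    hadamard-selfAdjoint u v = begin
      ∑ V (λ y → ∑ V (λ x → u x * χ x y) * conj (v y))    ≈⟨ ∑-cong V (λ y → ∑-*ʳ V (conj (v y)) _) ⟨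
      ∑ V (λ y → ∑ V (λ x → (u x * χ x y) * conj (v y)))  ≈⟨ ∑-comm V V _ ⟩
      ∑ V (λ x → ∑ V (λ y → (u x * χ x y) * conj (v y)))  ≈⟨ ∑-cong V (λ x → ∑-cong V (λ y → kernel x y)) ⟩
      ∑ V (λ x → ∑ V (λ y → u x * conj (v y * χ y x)))    ≈⟨ ∑-cong V (λ x → ∑-*ˡ V (u x) _) ⟩
      ∑ V (λ x → u x * ∑ V (λ y → conj (v y * χ y x)))    ≈⟨ ∑-cong V (λ x → *-congˡ (conj-∑ V _)) ⟨
      ∑ V (λ x → u x * conj (hadamard v x))               ∎
      where
      V : List (Vec Bool m)
      V = vecs m
      χ : Vec Bool m → Vec Bool m → Carrier
      χ x y = sgn (dot x y)
      kernel : ∀ x y → (u x * χ x y) * conj (v y) ≈ u x * conj (v y * χ y x)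
      kernel x y = begin
        (u x * χ x y) * conj (v y)             ≈⟨ *-assoc _ _ _ ⟩
        u x * (χ x y * conj (v y))             ≈⟨ *-congˡ (*-comm _ _) ⟩
        u x * (conj (v y) * χ x y)             ≈⟨ *-congˡ (*-congˡ (reflexive (≡.cong sgn (dot-comm x y)))) ⟩
        u x * (conj (v y) * χ y x)             ≈⟨ *-congˡ (*-congˡ (conj-sgn (dot y x))) ⟨
        u x * (conj (v y) * conj (χ y x))      ≈⟨ *-congˡ (conj-* _ _) ⟨
        u x * conj (v y * χ y x)               ∎

  transfer : ∀ {m} {λ₀ κ : Carrier} {U V Z W : Fun m} → conj λ₀ ≈ λ₀ → ¬ λ₀ ≈ 0# → conj κ ≈ κ →
             λ₀ ⊛ U ≐ κ ⊛ hadamard V → λ₀ ⊛ Z ≐ κ ⊛ hadamard W → ⟪ U , W ⟫ ≈ ⟪ V , Z ⟫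
  transfer {λ₀ = λ₀} {κ} {U} {V} {Z} {W} λ₀-real λ₀≉0 κ-real U↦V Z↦W = *-cancelˡ λ₀≉0 (begin
    λ₀ * ⟪ U , W ⟫                ≈⟨ ⟪⟫-⊛ˡ λ₀ U W ⟨
    ⟪ λ₀ ⊛ U , W ⟫                ≈⟨ ⟪⟫-congˡ W U↦V ⟩
    ⟪ κ ⊛ hadamard V , W ⟫        ≈⟨ ⟪⟫-⊛ˡ κ (hadamard V) W ⟩
    κ * ⟪ hadamard V , W ⟫        ≈⟨ *-congˡ (hadamard-selfAdjoint V W) ⟩
    κ * ⟪ V , hadamard W ⟫        ≈⟨ *-congʳ κ-real ⟨
    conj κ * ⟪ V , hadamard W ⟫   ≈⟨ ⟪⟫-⊛ʳ κ V (hadamard W) ⟨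
    ⟪ V , κ ⊛ hadamard W ⟫        ≈⟨ ⟪⟫-congʳ V Z↦W ⟨
    ⟪ V , λ₀ ⊛ Z ⟫                ≈⟨ ⟪⟫-⊛ʳ λ₀ V Z ⟩
    conj λ₀ * ⟪ V , Z ⟫           ≈⟨ *-congʳ λ₀-real ⟩
    λ₀ * ⟪ V , Z ⟫                ∎)

  walsh₂ : (Bool → Bool → Carrier) → Bool → Bool → Carrier
  walsh₂ g c d = (term false false + term false true) + (term true false + term true true)
    where
    term : Bool → Bool → Carrier
    term a b = sgn (a ∧ c) * (sgn (b ∧ d) * g a b)

  walsh₂-transpose : ∀ g c d → walsh₂ (λ a b → g b a) c d ≈ walsh₂ g d c
  walsh₂-transpose g c d = trans (+-interchange _ _ _ _)
    (+-cong (+-cong (x∙yz≈y∙xz _ _ _) (x∙yz≈y∙xz _ _ _)) (+-cong (x∙yz≈y∙xz _ _ _) (x∙yz≈y∙xz _ _ _)))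

  walsh₂-row-sum : ∀ g c e →
    walsh₂ g c false + sgn e * walsh₂ g c true ≈ (1# + 1#) * (g false e + sgn c * g true e)
  walsh₂-row-sum g c false = solve 5 (λ s g₀₀ g₀₁ g₁₀ g₁₁ →
      ((ı :* (ı :* g₀₀) :+ ı :* (ı :* g₀₁)) :+ (s :* (ı :* g₁₀) :+ s :* (ı :* g₁₁)))
      :+ ı :* ((ı :* (ı :* g₀₀) :+ ı :* (-ı :* g₀₁)) :+ (s :* (ı :* g₁₀) :+ s :* (-ı :* g₁₁)))
      := (ı :+ ı) :* (g₀₀ :+ s :* g₁₀))
    refl (sgn c) (g false false) (g false true) (g true false) (g true true)
    where ı = con (+ 1); -ı = :- con (+ 1)
  walsh₂-row-sum g c true = solve 5 (λ s g₀₀ g₀₁ g₁₀ g₁₁ →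
      ((ı :* (ı :* g₀₀) :+ ı :* (ı :* g₀₁)) :+ (s :* (ı :* g₁₀) :+ s :* (ı :* g₁₁)))
      :+ -ı :* ((ı :* (ı :* g₀₀) :+ ı :* (-ı :* g₀₁)) :+ (s :* (ı :* g₁₀) :+ s :* (-ı :* g₁₁)))
      := (ı :+ ı) :* (g₀₁ :+ s :* g₁₁))
    refl (sgn c) (g false false) (g false true) (g true false) (g true true)
    where ı = con (+ 1); -ı = :- con (+ 1)

  walsh-split : ∀ {m} (u : Fun (suc (suc m))) c d z →
    hadamard u (c ∷ d ∷ z) ≈ walsh₂ (λ a b → hadamard (λ x → u (a ∷ b ∷ x)) z) c d
  walsh-split {m} u c d z = trans (Σ𝔽₂-suc (suc m) (λ x → u x * sgn (dot x (c ∷ d ∷ z))))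
    (trans (+-cong (Σ𝔽₂-suc m _) (Σ𝔽₂-suc m _))
           (+-cong (+-cong (quarter false false) (quarter false true))
                   (+-cong (quarter true false) (quarter true true))))
    where
    quarter : ∀ a b →
      Σ𝔽₂ m (λ x → u (a ∷ b ∷ x) * sgn ((a ∧ c) xor ((b ∧ d) xor dot x z)))
        ≈ sgn (a ∧ c) * (sgn (b ∧ d) * hadamard (λ x → u (a ∷ b ∷ x)) z)
    quarter a b = begin
      Σ𝔽₂ m (λ x → u (a ∷ b ∷ x) * sgn ((a ∧ c) xor ((b ∧ d) xor dot x z)))
        ≈⟨ ∑-cong (vecs m) (λ x → *-congˡ (trans (sgn-xor _ _) (*-congˡ (sgn-xor _ _)))) ⟩
      Σ𝔽₂ m (λ x → u (a ∷ b ∷ x) * (sgn (a ∧ c) * (sgn (b ∧ d) * sgn (dot x z))))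
        ≈⟨ ∑-cong (vecs m) (λ x → trans (x∙yz≈y∙xz _ _ _) (*-congˡ (x∙yz≈y∙xz _ _ _))) ⟩
      Σ𝔽₂ m (λ x → sgn (a ∧ c) * (sgn (b ∧ d) * (u (a ∷ b ∷ x) * sgn (dot x z))))
        ≈⟨ trans (∑-*ˡ (vecs m) _ _) (*-congˡ (∑-*ˡ (vecs m) _ _)) ⟩
      sgn (a ∧ c) * (sgn (b ∧ d) * hadamard (λ x → u (a ∷ b ∷ x)) z) ∎

  transpose : ∀ {m} → (Bool → Bool → Fun m) → Bool → Bool → Fun m
  transpose F a b = F b a

  QuarterDual : ∀ {m} → Carrier → (Bool → Bool → Fun m) → Set ℓ
  QuarterDual λ₀ F = ∀ c d z → λ₀ * F c d z ≈ walsh₂ (λ a b → hadamard (F a b) z) c d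

  quarterDual-transpose : ∀ {m λ₀} {F : Bool → Bool → Fun m} →
                          QuarterDual λ₀ F → QuarterDual λ₀ (transpose F)
  quarterDual-transpose {F = F} dual c d z =
    trans (dual d c z) (sym (walsh₂-transpose (λ a b → hadamard (F a b) z) c d))

  -- row (transpose F) e c is the column combination F 0 e + (-1)^c F 1 e.
  row : ∀ {m} → (Bool → Bool → Fun m) → Bool → Bool → Fun m
  row F c e = F c false ⊕ sgn e ⊛ F c true

  row-hadamard : ∀ {m λ₀} {F : Bool → Bool → Fun m} → QuarterDual λ₀ F →
                 ∀ c e → λ₀ ⊛ row F c e ≐ (1# + 1#) ⊛ hadamard (row (transpose F) e c)
  row-hadamard {λ₀ = λ₀} {F} dual c e z = begin
    λ₀ * (F c false z + sgn e * F c true z)          ≈⟨ trans (distribˡ _ _ _) (+-congˡ (x∙yz≈y∙xz _ _ _)) ⟩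
    λ₀ * F c false z + sgn e * (λ₀ * F c true z)     ≈⟨ +-cong (dual c false z) (*-congˡ (dual c true z)) ⟩
    walsh₂ g c false + sgn e * walsh₂ g c true       ≈⟨ walsh₂-row-sum g c e ⟩
    (1# + 1#) * (g false e + sgn c * g true e)       ≈⟨ *-congˡ (trans (hadamard-⊕ _ _ z) (+-congˡ (hadamard-⊛ _ _ z))) ⟨
    (1# + 1#) * hadamard (row (transpose F) e c) z   ∎
    where
    g : Bool → Bool → Carrier
    g a b = hadamard (F a b) z

  ⟪⟫-sum-difference : ∀ {m} (u v : Fun m) → ⟪ u , u ⟫ ≈ ⟪ v , v ⟫ →
                      ⟪ u ⊕ sgn false ⊛ v , u ⊕ sgn true ⊛ v ⟫ ≈ conj ⟪ u , v ⟫ - ⟪ u , v ⟫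
  ⟪⟫-sum-difference u v ‖u‖≈‖v‖ = begin
    ⟪ u ⊕ sgn false ⊛ v , u ⊕ sgn true ⊛ v ⟫
      ≈⟨ ⟪⟫-expand u v u v (sgn false) (sgn true) (conj-sgn true) ⟩
    (⟪ u , u ⟫ + - 1# * ⟪ u , v ⟫) + (1# * ⟪ v , u ⟫ + 1# * (- 1# * ⟪ v , v ⟫))
      ≈⟨ +-congˡ (+-cong (*-congˡ (conj-⟪⟫ u v)) (*-congˡ (*-congˡ ‖u‖≈‖v‖))) ⟨
    (⟪ u , u ⟫ + - 1# * ⟪ u , v ⟫) + (1# * conj ⟪ u , v ⟫ + 1# * (- 1# * ⟪ u , u ⟫))
      ≈⟨ cancel-norms ⟪ u , u ⟫ ⟪ u , v ⟫ (conj ⟪ u , v ⟫) ⟩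
    conj ⟪ u , v ⟫ - ⟪ u , v ⟫ ∎
    where
    cancel-norms : ∀ n p p̄ → (n + - 1# * p) + (1# * p̄ + 1# * (- 1# * n)) ≈ p̄ - p
    cancel-norms = solve 3 (λ n p p̄ → (n :+ -ı :* p) :+ (ı :* p̄ :+ ı :* (-ı :* n)) := p̄ :- p) refl
      where ı = con (+ 1); -ı = :- con (+ 1)

  quarter-pairing : ∀ {m λ₀ N} (F : Bool → Bool → Fun m) → conj λ₀ ≈ λ₀ → ¬ λ₀ ≈ 0# →
                    (∀ a b → ⟪ F a b , F a b ⟫ ≈ N) → QuarterDual λ₀ F →
                    ⟪ F false false , F false true ⟫ + ⟪ F true false , F true true ⟫ ≈ 0#
  quarter-pairing {m} F λ₀-real λ₀≉0 norm dual = conj≈3*⇒≈0 (begin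
    conj (a + b)                                           ≈⟨ conj-+ a b ⟩
    conj a + conj b                                        ≈⟨ regroup a b (conj a) (conj b) ⟩
    ((conj a - a) + (conj b - b)) + (a + b)                ≈⟨ +-congʳ (+-cong (row-pairing false) (row-pairing true)) ⟩
    (⟪ col false false , col true false ⟫ + ⟪ col false true , col true true ⟫) + (a + b)
                                                           ≈⟨ +-congʳ (+-cong (expand false) (expand true)) ⟩
    (columns (sgn false) + columns (sgn true)) + (a + b)   ≈⟨ collect a b x y ⟩
    (a + b) + ((a + b) + (a + b))                          ∎)
    where
    a b x y : Carrier
    a = ⟪ F false false , F false true ⟫
    b = ⟪ F true false , F true true ⟫
    x = ⟪ F false false , F true true ⟫
    y = ⟪ F true false , F false true ⟫

    col : Bool → Bool → Fun m
    col = row (transpose F)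

    columns : Carrier → Carrier
    columns σ = (a + σ * x) + (σ * y + σ * (σ * b))

    row-pairing : ∀ c → conj ⟪ F c false , F c true ⟫ - ⟪ F c false , F c true ⟫
                        ≈ ⟪ col false c , col true c ⟫
    row-pairing c = trans
      (sym (⟪⟫-sum-difference (F c false) (F c true) (trans (norm c false) (sym (norm c true)))))
      (transfer λ₀-real λ₀≉0 conj-two (row-hadamard dual c false) (row-hadamard (quarterDual-transpose dual) true c))

    expand : ∀ c → ⟪ col false c , col true c ⟫ ≈ columns (sgn c)
    expand c = ⟪⟫-expand (F false false) (F true false) (F false true) (F true true) (sgn c) (sgn c) (conj-sgn c)

    regroup : ∀ a b ā b̄ → ā + b̄ ≈ ((ā - a) + (b̄ - b)) + (a + b)
    regroup = solve 4 (λ a b ā b̄ → ā :+ b̄ := ((ā :- a) :+ (b̄ :- b)) :+ (a :+ b)) refl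

    collect : ∀ a b x y →
      (((a + 1# * x) + (1# * y + 1# * (1# * b))) + ((a + - 1# * x) + (- 1# * y + - 1# * (- 1# * b)))) + (a + b)
        ≈ (a + b) + ((a + b) + (a + b))
    collect = solve 4 (λ a b x y →
        (((a :+ ı :* x) :+ (ı :* y :+ ı :* (ı :* b))) :+ ((a :+ -ı :* x) :+ (-ı :* y :+ -ı :* (-ı :* b)))) :+ (a :+ b)
        := (a :+ b) :+ ((a :+ b) :+ (a :+ b)))
      refl
      where ı = con (+ 1); -ı = :- con (+ 1)

theorem4 : {c ℓ : Level} (K : ComplexModel c ℓ) →
    let open ComplexModel K in
    let open WithModel K in
    (q : ℕ) → 2 ≤ q → 2 ∣ q →
    (m : ℕ) → 2 ≤ m →
    (ω λ₀ : Carrier) → IsPrimitiveRoot ω q → ω * conj ω ≈ 1# →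
    conj λ₀ ≈ λ₀ → λ₀ * λ₀ ≈ fromℕ 2 ^ (suc (suc m)) →
    (f : Vec Bool (suc (suc m)) → Fin q) → SelfDualGBent ω λ₀ f →
    (innerF ω f false false false true + innerF ω f true false true true ≈ 0#)
    × (innerF ω f false false true false + innerF ω f false true true true ≈ 0#)
theorem4 K _ _ _ m _ ω λ₀ _ ω-unit λ₀-real λ₀² f self-dual =
    quarter-pairing F λ₀-real λ₀≉0 norm dual
  , quarter-pairing (transpose F) λ₀-real λ₀≉0 (λ a b → norm b a) (quarterDual-transpose dual)
  where
  open ComplexModel K
  open WithModel K
  open WalshAnalysis K

  F : Bool → Bool → Fun m
  F a b x = wpow ω f (a ∷ b ∷ x)

  λ₀≉0 : ¬ λ₀ ≈ 0#
  λ₀≉0 = root-nonzero (^-nonzero (char0 1) (suc (suc m))) λ₀²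

  norm : ∀ a b → ⟪ F a b , F a b ⟫ ≈ Σ𝔽₂ m (λ _ → 1#)
  norm a b = ∑-cong (vecs m) (λ x → unit-^ ω-unit (toℕ (f (a ∷ b ∷ x))))

  dual : QuarterDual λ₀ F
  dual c d z = trans (sym (self-dual (c ∷ d ∷ z))) (walsh-split (wpow ω f) c d z)
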